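{- Let $k\ge2$, let $G$ be a connected $\mathcal{C}_k$-symmetric graph with a countably infinite vertex set, and let $(G_n)_{n\in\mathbb{N}}$ be a $\mathcal{C}_k$-symmetric subgraph tower in $G$. Let $e_1,e_2$ be edges of $G_1$. If for every $n\in\mathbb{N}$ there is a $\mathcal{C}_k$-symmetric NAC-coloring $\delta_n$ of $G_n$ with $\delta_n(e_1)\neq\delta_n(e_2)$, then $G$ has a $\mathcal{C}_k$-symmetric NAC-coloring.
   Context: Let $\mathcal{C}_k=\langle\omega:\omega^k=1\rangle$ act on $G$ via an injective homomorphism $\theta\colon\mathcal{C}_k\to\mathrm{Aut}(G)$; write $\gamma v=\theta(\gamma)(v)$, $\gamma(uv)=(\gamma u)(\gamma v)$. A vertex is invariant if fixed by all $\gamma$, partially invariant if fixed by some $\gamma\neq1$. $G$ is $\mathcal{C}_k$-symmetric if every partially invariant vertex is invariant and invariant vertices form an independent set. A subgraph tower in $G$ is a sequence $(G_n)$ of finite connected induced subgraphs with $G_n$ a proper subgraph of $G_{n+1}$ and $\bigcup_n V_{G_n}=V_G$; it is $\mathcal{C}_k$-symmetric if each $\theta(\gamma)$ restricts to an automorphism of each $G_n$ (so each $G_n$ carries the restricted action). A NAC-coloring of a graph $H$ is a surjective $\delta\colon E_H\to\{\text{red},\text{blue}\}$ such that every (finite) cycle is monochromatic or has at least two edges of each color. Red (resp. blue) components are connected components of the spanning subgraph of red (resp. blue) edges; a component $K$ is partially invariant if $\gamma K=K$ for some $\gamma\neq1$. $\delta$ is $\mathcal{C}_k$-symmetric if $\delta(\gamma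 e)=\delta(e)$ for all $e,\gamma$ and no two distinct red partially invariant components, and no two distinct blue partially invariant components, are joined by an edge. -}

module Defs where

open import Level using (0ℓ)
open import Data.Nat using (ℕ; zero; suc; _≤_; _<_)
open import Data.Bool using (Bool; true; false; _≟_)
open import Data.Unit using (⊤)
open import Data.List using (List; []; _∷_; _++_; [_]; map; length)
open import Data.List.Membership.Propositional using (_∈_; _∉_)
open import Data.List.Relation.Unary.All using (All)
open import Data.List.Relation.Unary.Unique.Propositional using (Unique)
open import Data.Product using (Σ; ∃; ∃-syntax; _×_; _,_; proj₁; proj₂)
open import Data.Sum using (_⊎_)
open import Relation.Nullary using (¬_; yes; no)
open import Relation.Binary.PropositionalEquality using (_≡_; _≢_)

-- Graphs with the countably infinite vertex set ℕ (simple, undirected)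

record Graph : Set where
  field
    E        : ℕ → ℕ → Bool
    E-sym    : ∀ u v → E u v ≡ E v u
    E-irrefl : ∀ v → E v v ≡ false

Edge : Graph → ℕ → ℕ → Set
Edge G u v = Graph.E G u v ≡ true

-- vertex sets (subgraphs are induced subgraphs given by a vertex set)
VSet : Set₁
VSet = ℕ → Set

AllV : VSet
AllV _ = ⊤

EdgeIn : Graph → VSet → ℕ → ℕ → Set
EdgeIn G V u v = V u × V v × Edge G u v

data Reach (R : ℕ → ℕ → Set) : ℕ → ℕ → Set where
  here : ∀ {u} → Reach R u u
  step : ∀ {u v w} → R u v → Reach R v w → Reach R u w

Connected : Graph → VSet → Set
Connected G V = ∀ u v → V u → V v → Reach (EdgeIn G V) u v

iter : ℕ → (ℕ → ℕ) → ℕ → ℕ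
iter zero    f x = x
iter (suc n) f x = f (iter n f x)

-- An injective homomorphism θ : C_k → Aut(G), given by σ = θ(ω).
-- The group elements are γ = ω^j (j < k), acting by iter j σ.
record CAction (k : ℕ) (G : Graph) : Set where
  field
    σ          : ℕ → ℕ
    σ-aut      : ∀ u v → Graph.E G (σ u) (σ v) ≡ Graph.E G u v
    σ-order    : ∀ v → iter k σ v ≡ v                       -- θ is a homomorphism
    σ-faithful : ∀ j → 1 ≤ j → j < k → ∃[ v ] iter j σ v ≢ v  -- θ is injective

module _ {k : ℕ} {G : Graph} (A : CAction k G) where
  open CAction A

  act : ℕ → ℕ → ℕ
  act j = iter j σ

  Invariant : ℕ → Set
  Invariant v = ∀ j → j < k → act j v ≡ v

  PartiallyInvariant : ℕ → Set
  PartiallyInvariant v = ∃[ j ] (1 ≤ j × j < k × act j v ≡ v)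

  SymmetricGraph : Set
  SymmetricGraph =
    (∀ v → PartiallyInvariant v → Invariant v) ×
    (∀ u v → Invariant u → Invariant v → ¬ Edge G u v)

  closedPairsAux : ℕ → List ℕ → List (ℕ × ℕ)
  closedPairsAux x₀ []           = []
  closedPairsAux x₀ (a ∷ [])     = (a , x₀) ∷ []
  closedPairsAux x₀ (a ∷ b ∷ r)  = (a , b) ∷ closedPairsAux x₀ (b ∷ r)

  -- consecutive pairs of a closed walk v₀ v₁ … v_{m-1} v₀
  closedPairs : List ℕ → List (ℕ × ℕ)
  closedPairs []       = []
  closedPairs (x ∷ xs) = closedPairsAux x (x ∷ xs)

  IsCycle : VSet → List ℕ → Set
  IsCycle V vs = 3 ≤ length vs × Unique vs × All V vs ×
                 All (λ p → Edge G (proj₁ p) (proj₂ p)) (closedPairs vs)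

  count : Bool → List Bool → ℕ
  count c []       = 0
  count c (x ∷ xs) with x ≟ c
  ... | yes _ = suc (count c xs)
  ... | no  _ = count c xs

  NACCond : List Bool → Set
  NACCond cs = All (_≡ true) cs ⊎ All (_≡ false) cs ⊎ (2 ≤ count true cs × 2 ≤ count false cs)

  -- δ is an edge colouring of G[V] (values on non-edges are irrelevant)
  IsNAC : VSet → (ℕ → ℕ → Bool) → Set
  IsNAC V δ =
    (∀ u v → EdgeIn G V u v → δ u v ≡ δ v u) ×
    (∃[ u ] ∃[ v ] (EdgeIn G V u v × δ u v ≡ true)) ×
    (∃[ u ] ∃[ v ] (EdgeIn G V u v × δ u v ≡ false)) ×
    (∀ vs → IsCycle V vs → NACCond (map (λ p → δ (proj₁ p) (proj₂ p)) (closedPairs vs)))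

  ColConn : VSet → (ℕ → ℕ → Bool) → Bool → ℕ → ℕ → Set
  ColConn V δ c = Reach (λ a b → EdgeIn G V a b × δ a b ≡ c)

  -- the c-coloured component K of u satisfies γ K = K for some γ ≠ 1
  PartInvComp : VSet → (ℕ → ℕ → Bool) → Bool → ℕ → Set
  PartInvComp V δ c u =
    ∃[ j ] (1 ≤ j × j < k ×
      (∀ w → (ColConn V δ c u w → ∃[ w' ] (ColConn V δ c u w' × act j w' ≡ w)) ×
             (∃[ w' ] (ColConn V δ c u w' × act j w' ≡ w) → ColConn V δ c u w)))

  -- C_k-symmetric NAC-coloring of G[V] (V assumed invariant under the action)
  SymNAC : VSet → (ℕ → ℕ → Bool) → Set
  SymNAC V δ =
    IsNAC V δ ×
    (∀ j → j < k → ∀ u v → EdgeIn G V u v → δ (act j u) (act j v) ≡ δ u v) ×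
    (∀ c u v → EdgeIn G V u v → PartInvComp V δ c u → PartInvComp V δ c v →
       ¬ ¬ ColConn V δ c u v)

-- Subgraph towers (finite connected induced subgraphs given by vertex lists)

record SubgraphTower (G : Graph) : Set where
  field
    V         : ℕ → List ℕ
    connected : ∀ n → Connected G (_∈ V n)
    sub       : ∀ n v → v ∈ V n → v ∈ V (suc n)
    proper    : ∀ n → ∃[ v ] (v ∈ V (suc n) × v ∉ V n)
    cover     : ∀ v → ∃[ n ] (v ∈ V n)

SymmetricTower : {k : ℕ} {G : Graph} → CAction k G → SubgraphTower G → Set
SymmetricTower {k} A T =
  ∀ n j → j < k →
    (∀ v → v ∈ SubgraphTower.V T n → act A j v ∈ SubgraphTower.V T n) ×
    (∀ w → w ∈ SubgraphTower.V T n → ∃[ v ] (v ∈ SubgraphTower.V T n × act A j v ≡ w))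

{-# OPTIONS --safe #-}

-- A compactness (König's lemma) argument.  By excluded middle, pass at stage m to an infinite
-- set of indices n on which the finitely many edge colours of G_m under δ_n are constant; the
-- resulting limit colouring δ agrees, for every m, with some δ_n (n ≥ m) on G_m.  Each defining
-- property of a symmetric NAC-colouring is witnessed by finitely many vertices (an edge, a cycle,
-- or a monochromatic walk from u to γu, which is what makes the component of u partially
-- invariant), so it passes from a suitable δ_n to δ; the edges e₁, e₂ keep both colours in use.
module Submission where

open import Defs
open import Level using (0ℓ)
open import Axiom.ExcludedMiddle using (ExcludedMiddle)
open import Axiom.DoubleNegationElimination using (em⇒dne)
open import Function using (_∘_)
open import Data.Bool using (Bool; true; false; if_then_else_)
open import Data.Bool.Properties using (¬-not)
import Data.Bool as Bool
open import Data.Nat using (ℕ; zero; suc; _≤_; _<_; _+_; _*_; _⊔_; pred; z≤n; s≤s; _≤′_; ≤′-refl; ≤′-step; >-nonZero)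
open import Data.Nat.Properties
  using (_≟_; ≤-refl; ≤-trans; m≤m⊔n; m≤n⊔m; ≤⇒≤′; *-comm; suc-pred; <-irrefl)
open import Data.Unit using (⊤; tt)
open import Data.List using (List; []; _∷_; _++_; [_]; map; length; replicate; cartesianProduct)
open import Data.List.Properties using (map-cong-local)
open import Data.List.Membership.Propositional using (_∈_)
open import Data.List.Membership.DecPropositional _≟_ using (_∈?_)
open import Data.List.Membership.Propositional.Properties using (∈-cartesianProduct⁺)
open import Data.List.Relation.Unary.Any using (here; there)
open import Data.List.Relation.Unary.All as All using (All; []; _∷_)
open import Data.List.Relation.Unary.All.Properties using (¬Any⇒All¬; ++⁻ʳ)
open import Data.List.Relation.Unary.AllPairs using ([]; _∷_)
open import Data.List.Relation.Unary.Unique.Propositional using (Unique)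
open import Data.Product using (∃-syntax; _×_; _,_; proj₁; proj₂)
open import Data.Product.Properties using (≡-dec)
open import Data.Sum using (inj₁; inj₂)
open import Relation.Binary.Definitions using (DecidableEquality)
open import Relation.Binary.PropositionalEquality
  using (_≡_; _≢_; refl; sym; trans; cong; cong₂; subst; ≢-sym; module ≡-Reasoning)
open import Relation.Nullary using (¬_; yes; no; does; contradiction)

Reach-map : ∀ {R S : ℕ → ℕ → Set} → (∀ {x y} → R x y → S x y) →
            ∀ {u v} → Reach R u v → Reach S u v
Reach-map f here         = here
Reach-map f (step r rs) = step (f r) (Reach-map f rs)

Reach-++ : ∀ {R u v w} → Reach R u v → Reach R v w → Reach R u w
Reach-++ here         qs = qs
Reach-++ (step r rs) qs = step r (Reach-++ rs qs)

data Path (R : ℕ → ℕ → Set) : ℕ → List ℕ → ℕ → Set where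
  stop : ∀ {u} → Path R u [] u
  _◅_  : ∀ {u w xs v} → R u w → Path R w xs v → Path R u (w ∷ xs) v

SimplePath : (ℕ → ℕ → Set) → ℕ → ℕ → Set
SimplePath R u v = ∃[ xs ] (Path R u xs v × Unique (u ∷ xs))

SimplePath-suffix : ∀ {R w xs v u} → Path R w xs v → Unique (w ∷ xs) → u ∈ w ∷ xs →
                    SimplePath R u v
SimplePath-suffix p        un       (here refl) = _ , p , un
SimplePath-suffix stop     _        (there ())
SimplePath-suffix (_ ◅ p) (_ ∷ un) (there u∈)  = SimplePath-suffix p un u∈

Reach⇒SimplePath : ∀ {R u v} → Reach R u v → SimplePath R u v
Reach⇒SimplePath here = [] , stop , [] ∷ []
Reach⇒SimplePath {u = u} (step {v = w} r rs) with Reach⇒SimplePath rs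
... | xs , p , un with u ∈? w ∷ xs
...   | yes u∈ = SimplePath-suffix p un u∈
...   | no u∉  = w ∷ xs , r ◅ p , ¬Any⇒All¬ (w ∷ xs) u∉ ∷ un

iter-+ : ∀ (f : ℕ → ℕ) m n x → iter (m + n) f x ≡ iter m f (iter n f x)
iter-+ f zero    n x = refl
iter-+ f (suc m) n x = cong f (iter-+ f m n x)

iter-* : ∀ (f : ℕ → ℕ) m n x → iter (m * n) f x ≡ iter m (iter n f) x
iter-* f zero    n x = refl
iter-* f (suc m) n x = trans (iter-+ f n (m * n) x) (cong (iter n f) (iter-* f m n x))

module _ {k : ℕ} {G : Graph} (A : CAction k G) where
  open CAction A

  ColEdge : VSet → (ℕ → ℕ → Bool) → Bool → ℕ → ℕ → Set
  ColEdge W δ c a b = EdgeIn G W a b × δ a b ≡ c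

  count-oneOff : ∀ {c d} n → c ≢ d → count A d (replicate n c ++ [ d ]) ≡ 1
  count-oneOff {d = d} zero _ with d Bool.≟ d
  ... | yes _   = refl
  ... | no d≢d = contradiction refl d≢d
  count-oneOff {c} {d} (suc n) c≢d with c Bool.≟ d
  ... | yes c≡d = contradiction c≡d c≢d
  ... | no _    = count-oneOff n c≢d

  ¬NACCond-oneOff : ∀ {c d} n → c ≢ d → ¬ NACCond A (replicate (suc n) c ++ [ d ])
  ¬NACCond-oneOff {c} n c≢d (inj₁ all≡true) =
    c≢d (trans (All.head all≡true) (sym (All.head (++⁻ʳ (replicate (suc n) c) all≡true))))
  ¬NACCond-oneOff {c} n c≢d (inj₂ (inj₁ all≡false)) =
    c≢d (trans (All.head all≡false) (sym (All.head (++⁻ʳ (replicate (suc n) c) all≡false))))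
  ¬NACCond-oneOff {d = true} n c≢d (inj₂ (inj₂ (two-true , _))) =
    <-irrefl refl (subst (2 ≤_) (count-oneOff (suc n) c≢d) two-true)
  ¬NACCond-oneOff {d = false} n c≢d (inj₂ (inj₂ (_ , two-false))) =
    <-irrefl refl (subst (2 ≤_) (count-oneOff (suc n) c≢d) two-false)

  closedPairs-All : ∀ {Q : ℕ → Set} {xs} → All Q xs →
                    All (λ p → Q (proj₁ p) × Q (proj₂ p)) (closedPairs A xs)
  closedPairs-All []                     = []
  closedPairs-All {Q} {x₀ ∷ _} (q₀ ∷ qs) = go (q₀ ∷ qs)
    where
      go : ∀ {xs} → All Q xs → All (λ p → Q (proj₁ p) × Q (proj₂ p)) (closedPairsAux A x₀ xs)
      go []             = []
      go (qa ∷ [])      = (qa , q₀) ∷ []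
      go (qa ∷ qb ∷ qs) = (qa , qb) ∷ go (qb ∷ qs)

  module _ {W : VSet} {δ : ℕ → ℕ → Bool} {c : Bool} where

    closedPairs-colours : ∀ {x₀ u xs v} → Path (ColEdge W δ c) u xs v →
      map (λ p → δ (proj₁ p) (proj₂ p)) (closedPairsAux A x₀ (u ∷ xs))
        ≡ replicate (length xs) c ++ [ δ v x₀ ]
    closedPairs-colours stop     = refl
    closedPairs-colours (r ◅ p) = cong₂ _∷_ (proj₂ r) (closedPairs-colours p)

    closedPairs-edges : ∀ {x₀ u xs v} → Edge G v x₀ → Path (ColEdge W δ c) u xs v →
      All (λ p → Edge G (proj₁ p) (proj₂ p)) (closedPairsAux A x₀ (u ∷ xs))
    closedPairs-edges e stop                       = e ∷ []
    closedPairs-edges e (((_ , _ , eᵣ) , _) ◅ p) = eᵣ ∷ closedPairs-edges e p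

    Path-vertices : ∀ {u xs v} → W v → Path (ColEdge W δ c) u xs v → All W (u ∷ xs)
    Path-vertices Wv stop                    = Wv ∷ []
    Path-vertices Wv (((Wu , _) , _) ◅ p) = Wu ∷ Path-vertices Wv p

    -- A c-path from u to v closed by the edge vu is a cycle with exactly one edge not of colour c.
    ¬ColConn-across-edge : ∀ {u v} → IsNAC A W δ → EdgeIn G W u v → δ u v ≢ c →
                           ¬ ColConn A W δ c u v
    ¬ColConn-across-edge {u} {v} nac uv@(_ , Wv , e) δuv≢c u~v with Reach⇒SimplePath u~v
    ... | [] , stop , _ = contradiction (trans (sym e) (Graph.E-irrefl G u)) λ ()
    ... | _ ∷ [] , r ◅ stop , _ = δuv≢c (proj₂ r)
    ... | xs@(_ ∷ ys@(_ ∷ _)) , p , un =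
      ¬NACCond-oneOff (length ys) c≢δvu (subst (NACCond A) (closedPairs-colours p)
        (proj₂ (proj₂ (proj₂ nac)) (u ∷ xs)
          (s≤s (s≤s (s≤s z≤n)) , un , Path-vertices Wv p , closedPairs-edges vu p)))
      where
        vu : Edge G v u
        vu = trans (Graph.E-sym G v u) e
        c≢δvu : c ≢ δ v u
        c≢δvu c≡δvu = δuv≢c (trans (proj₁ nac u v uv) (sym c≡δvu))

  act-edge : ∀ j u v → Graph.E G (act A j u) (act A j v) ≡ Graph.E G u v
  act-edge zero    u v = refl
  act-edge (suc j) u v = trans (σ-aut _ _) (act-edge j u v)

  act-multiple-of-order : ∀ m x → act A (m * k) x ≡ x
  act-multiple-of-order zero    x = refl
  act-multiple-of-order (suc m) x =
    trans (iter-+ σ k (m * k) x) (trans (cong (iter k σ) (act-multiple-of-order m x)) (σ-order x))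

  act-order : ∀ j x → iter k (act A j) x ≡ x
  act-order j x = begin
    iter k (act A j) x  ≡⟨ iter-* σ k j x ⟨
    iter (k * j) σ x    ≡⟨ cong (λ e → iter e σ x) (*-comm k j) ⟩
    iter (j * k) σ x    ≡⟨ act-multiple-of-order j x ⟩
    x                   ∎
    where open ≡-Reasoning

  PartInvComp⇒ColConn-act : ∀ {W δ c u} → PartInvComp A W δ c u →
                            ∃[ j ] (1 ≤ j × j < k × ColConn A W δ c u (act A j u))
  PartInvComp⇒ColConn-act (j , 1≤j , j<k , γK≡K) = j , 1≤j , j<k , proj₂ (γK≡K _) (_ , here , refl)

  module _ {W : VSet} {δ : ℕ → ℕ → Bool} {c : Bool} {j : ℕ}
           (W-closed : ∀ {x} → W x → W (act A j x))
           (δ-invariant : ∀ u v → EdgeIn G W u v → δ (act A j u) (act A j v) ≡ δ u v) where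

    ColConn-act : ∀ {a b} → ColConn A W δ c a b → ColConn A W δ c (act A j a) (act A j b)
    ColConn-act here = here
    ColConn-act (step ((Wa , Wb , e) , δab≡c) rs) =
      step ((W-closed Wa , W-closed Wb , trans (act-edge j _ _) e) ,
            trans (δ-invariant _ _ (Wa , Wb , e)) δab≡c)
           (ColConn-act rs)

    ColConn-iter-act : ∀ {u w} → ColConn A W δ c u (act A j u) → ColConn A W δ c u w →
                       ∀ t → ColConn A W δ c u (iter t (act A j) w)
    ColConn-iter-act u~γu u~w zero    = u~w
    ColConn-iter-act u~γu u~w (suc t) = Reach-++ u~γu (ColConn-act (ColConn-iter-act u~γu u~w t))

    -- The preimage of w under γ = ω^j is γ^(k-1) w, which stays in the component by iterating γ.
    ColConn-act⇒PartInvComp : ∀ {u} → 1 ≤ j → j < k → ColConn A W δ c u (act A j u) →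
                              PartInvComp A W δ c u
    ColConn-act⇒PartInvComp {u} 1≤j j<k u~γu = j , 1≤j , j<k , λ w →
      (λ u~w → iter (pred k) (act A j) w , ColConn-iter-act u~γu u~w (pred k) , γ-preimage w) ,
      (λ (w' , u~w' , γw'≡w) → subst (ColConn A W δ c u) γw'≡w (Reach-++ u~γu (ColConn-act u~w')))
      where
        γ-preimage : ∀ w → act A j (iter (pred k) (act A j) w) ≡ w
        γ-preimage w =
          trans (cong (λ e → iter e (act A j) w) (suc-pred k {{>-nonZero (≤-trans (s≤s z≤n) j<k)}}))
                (act-order j w)

Infinite : (ℕ → Set) → Set
Infinite P = ∀ m → ∃[ n ] (m ≤ n × P n)

Infinite-map : ∀ {P Q : ℕ → Set} → (∀ {n} → P n → Q n) → Infinite P → Infinite Q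
Infinite-map f inf m = let n , m≤n , Pn = inf m in n , m≤n , f Pn

module _ (em : ExcludedMiddle 0ℓ) where

  ¬Infinite⇒eventually-¬ : ∀ {P} → ¬ Infinite P → ∃[ m ] (∀ n → m ≤ n → ¬ P n)
  ¬Infinite⇒eventually-¬ ¬inf =
    dne λ ¬eventually → ¬inf λ m → dne λ ¬later → ¬eventually (m , λ n m≤n Pn → ¬later (n , m≤n , Pn))
    where dne = em⇒dne em

  Infinite-pigeonhole : ∀ {P} (f : ℕ → Bool) → Infinite P → ∃[ b ] Infinite (λ n → P n × f n ≡ b)
  Infinite-pigeonhole {P} f inf with em {Infinite (λ n → P n × f n ≡ true)}
  ... | yes inf-true = true , inf-true
  ... | no ¬inf-true = false , inf-false
    where
      inf-false : Infinite (λ n → P n × f n ≡ false)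
      inf-false m with ¬Infinite⇒eventually-¬ ¬inf-true
      ... | m₀ , never-true with inf (m ⊔ m₀)
      ... | n , m⊔m₀≤n , Pn =
        n , ≤-trans (m≤m⊔n m m₀) m⊔m₀≤n , Pn ,
        ¬-not (λ fn≡true → never-true n (≤-trans (m≤n⊔m m m₀) m⊔m₀≤n) (Pn , fn≡true))

  module _ {K : Set} (_≟ᴷ_ : DecidableEquality K) (Δ : ℕ → K → Bool) where

    AgreeOn : List K → (K → Bool) → ℕ → Set
    AgreeOn L g n = All (λ x → Δ n x ≡ g x) L

    Infinite-agreeOn : ∀ {P} (L : List K) → Infinite P →
                       ∃[ g ] Infinite (λ n → P n × AgreeOn L g n)
    Infinite-agreeOn []      inf = (λ _ → false) , Infinite-map (_, []) inf
    Infinite-agreeOn (x ∷ L) inf with Infinite-agreeOn L inf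
    ... | g , inf-g with Infinite-pigeonhole (λ n → Δ n x) inf-g
    ... | b , inf-b = g′ , Infinite-map (λ ((Pn , agree) , Δnx≡b) →
                              Pn , agree-x Δnx≡b ∷ All.map (agree-rest Δnx≡b) agree) inf-b
      where
        g′ : K → Bool
        g′ y = if does (y ≟ᴷ x) then b else g y
        agree-x : ∀ {n} → Δ n x ≡ b → Δ n x ≡ g′ x
        agree-x Δnx≡b with x ≟ᴷ x
        ... | yes _   = Δnx≡b
        ... | no x≢x = contradiction refl x≢x
        agree-rest : ∀ {n y} → Δ n x ≡ b → Δ n y ≡ g y → Δ n y ≡ g′ y
        agree-rest {y = y} Δnx≡b Δny≡gy with y ≟ᴷ x
        ... | yes refl = Δnx≡b
        ... | no _     = Δny≡gy

    module _ (L : ℕ → List K) (L-covers : ∀ x → ∃[ m ] (x ∈ L m)) where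

      Survivors : ℕ → ℕ → Set
      Survivors-infinite : ∀ m → Infinite (Survivors m)
      chosen : ℕ → K → Bool

      Survivors zero    n = ⊤
      Survivors (suc m) n = Survivors m n × AgreeOn (L m) (chosen m) n
      chosen m = proj₁ (Infinite-agreeOn (L m) (Survivors-infinite m))
      Survivors-infinite zero    m = m , ≤-refl , tt
      Survivors-infinite (suc m) = proj₂ (Infinite-agreeOn (L m) (Survivors-infinite m))

      Survivors-antitone : ∀ {m m′ n} → m ≤′ m′ → Survivors m′ n → Survivors m n
      Survivors-antitone ≤′-refl          s = s
      Survivors-antitone (≤′-step m≤′m′) s = Survivors-antitone m≤′m′ (proj₁ s)

      Survivors-agree : ∀ {m n x} → Survivors (suc m) n → x ∈ L m → Δ n x ≡ chosen m x
      Survivors-agree (_ , agree) x∈ = All.lookup agree x∈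

      chosen-coherent : ∀ {i j x} → x ∈ L i → x ∈ L j → chosen i x ≡ chosen j x
      chosen-coherent {i} {j} x∈Lᵢ x∈Lⱼ =
        let n , _ , s = Survivors-infinite (suc (i ⊔ j)) 0
            sᵢ = Survivors-antitone (≤⇒≤′ (s≤s (m≤m⊔n i j))) s
            sⱼ = Survivors-antitone (≤⇒≤′ (s≤s (m≤n⊔m i j))) s
        in trans (sym (Survivors-agree sᵢ x∈Lᵢ)) (Survivors-agree sⱼ x∈Lⱼ)

      compactness : ∃[ g ] (∀ m → ∃[ n ] (m ≤ n × ∀ {x} → x ∈ L m → Δ n x ≡ g x))
      compactness = limit , λ m →
        let n , m≤n , s = Survivors-infinite (suc m) m
        in n , m≤n , λ x∈ → trans (Survivors-agree s x∈) (chosen-coherent x∈ (proj₂ (L-covers _)))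
        where
          limit : K → Bool
          limit x = chosen (proj₁ (L-covers x)) x

module _ {G : Graph} (T : SubgraphTower G) where
  open SubgraphTower T

  V-mono′ : ∀ {m m′ v} → m ≤′ m′ → v ∈ V m → v ∈ V m′
  V-mono′ ≤′-refl          v∈ = v∈
  V-mono′ (≤′-step m≤′m′) v∈ = sub _ _ (V-mono′ m≤′m′ v∈)

  V-mono : ∀ {m m′ v} → m ≤ m′ → v ∈ V m → v ∈ V m′
  V-mono = V-mono′ ∘ ≤⇒≤′

  pair-inStage : ∀ u v → ∃[ m ] (u ∈ V m × v ∈ V m)
  pair-inStage u v =
    let mᵤ , u∈ = cover u
        mᵥ , v∈ = cover v
    in mᵤ ⊔ mᵥ , V-mono (m≤m⊔n mᵤ mᵥ) u∈ , V-mono (m≤n⊔m mᵤ mᵥ) v∈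

  list-inStage : ∀ xs → ∃[ m ] All (_∈ V m) xs
  list-inStage []       = 0 , []
  list-inStage (x ∷ xs) =
    let mₓ , x∈ = cover x
        m , xs∈ = list-inStage xs
    in mₓ ⊔ m , V-mono (m≤m⊔n mₓ m) x∈ ∷ All.map (V-mono (m≤n⊔m mₓ m)) xs∈

  InStage : ℕ → (ℕ → ℕ → Set) → ℕ → ℕ → Set
  InStage m R x y = R x y × x ∈ V m × y ∈ V m

  Reach-inStage : ∀ {R a b} → Reach R a b → ∃[ m ] (a ∈ V m × Reach (InStage m R) a b)
  Reach-inStage {a = a} here = proj₁ (cover a) , proj₂ (cover a) , here
  Reach-inStage {a = a} (step r rs) =
    let mₐ , a∈ = cover a
        m , w∈ , walk = Reach-inStage rs
        up : ∀ {x} → x ∈ V m → x ∈ V (mₐ ⊔ m)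
        up = V-mono (m≤n⊔m mₐ m)
    in mₐ ⊔ m , V-mono (m≤m⊔n mₐ m) a∈ ,
       step (r , V-mono (m≤m⊔n mₐ m) a∈ , up w∈) (Reach-map (λ (r , x∈ , y∈) → r , up x∈ , up y∈) walk)

module Limit (em : ExcludedMiddle 0ℓ) {k : ℕ} {G : Graph} (A : CAction k G)
             (T : SubgraphTower G) (Δ : ℕ → ℕ → ℕ → Bool) where
  open SubgraphTower T

  private
    pairs : ℕ → List (ℕ × ℕ)
    pairs m = cartesianProduct (V m) (V m)

    pairs-cover : ∀ xy → ∃[ m ] (xy ∈ pairs m)
    pairs-cover (x , y) = let m , x∈ , y∈ = pair-inStage T x y in m , ∈-cartesianProduct⁺ x∈ y∈

    limit : ∃[ g ] (∀ m → ∃[ n ] (m ≤ n × ∀ {xy} → xy ∈ pairs m → Δ n (proj₁ xy) (proj₂ xy) ≡ g xy))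
    limit = compactness em (≡-dec _≟_ _≟_) (λ n (x , y) → Δ n x y) pairs pairs-cover

  δ : ℕ → ℕ → Bool
  δ x y = proj₁ limit (x , y)

  Agrees : ℕ → ℕ → Set
  Agrees m n = m ≤ n × (∀ {x y} → x ∈ V m → y ∈ V m → Δ n x y ≡ δ x y)

  agreeing : ∀ m → ∃[ n ] Agrees m n
  agreeing m = let n , m≤n , agree = proj₂ limit m in
    n , m≤n , λ x∈ y∈ → agree (∈-cartesianProduct⁺ x∈ y∈)

  Agrees-weaken : ∀ {m′ m n} → m′ ≤ m → Agrees m n → Agrees m′ n
  Agrees-weaken m′≤m (m≤n , agree) =
    ≤-trans m′≤m m≤n , λ x∈ y∈ → agree (V-mono T m′≤m x∈) (V-mono T m′≤m y∈)

  module _ (ST : SymmetricTower A T) (Δ-symNAC : ∀ n → SymNAC A (_∈ V n) (Δ n)) where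

    δ-sym : ∀ u v → EdgeIn G AllV u v → δ u v ≡ δ v u
    δ-sym u v (_ , _ , e) =
      let m , u∈ , v∈ = pair-inStage T u v
          n , m≤n , agree = agreeing m
          Δn-sym = proj₁ (proj₁ (Δ-symNAC n))
      in begin
        δ u v    ≡⟨ agree u∈ v∈ ⟨
        Δ n u v  ≡⟨ Δn-sym u v (V-mono T m≤n u∈ , V-mono T m≤n v∈ , e) ⟩
        Δ n v u  ≡⟨ agree v∈ u∈ ⟩
        δ v u    ∎
      where open ≡-Reasoning

    δ-invariant : ∀ j → j < k → ∀ u v → EdgeIn G AllV u v → δ (act A j u) (act A j v) ≡ δ u v
    δ-invariant j j<k u v (_ , _ , e) =
      let m , u∈ , v∈ = pair-inStage T u v
          n , m≤n , agree = agreeing m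
          γ-closed = proj₁ (ST m j j<k)
          Δn-invariant = proj₁ (proj₂ (Δ-symNAC n))
      in begin
        δ (act A j u) (act A j v)    ≡⟨ agree (γ-closed u u∈) (γ-closed v v∈) ⟨
        Δ n (act A j u) (act A j v)  ≡⟨ Δn-invariant j j<k u v (V-mono T m≤n u∈ , V-mono T m≤n v∈ , e) ⟩
        Δ n u v                      ≡⟨ agree u∈ v∈ ⟩
        δ u v                        ∎
      where open ≡-Reasoning

    δ-cycles : ∀ vs → IsCycle A AllV vs →
               NACCond A (map (λ p → δ (proj₁ p) (proj₂ p)) (closedPairs A vs))
    δ-cycles vs (3≤|vs| , unique , _ , edges) =
      let m , vs∈ = list-inStage T vs
          n , m≤n , agree = agreeing m
          Δn-cycles = proj₂ (proj₂ (proj₂ (proj₁ (Δ-symNAC n))))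
      in subst (NACCond A)
           (map-cong-local (All.map (λ (x∈ , y∈) → agree x∈ y∈) (closedPairs-All A vs∈)))
           (Δn-cycles vs (3≤|vs| , unique , All.map (V-mono T m≤n) vs∈ , edges))

    PartInvComp-localise : ∀ {c u} → PartInvComp A AllV δ c u →
      ∃[ m ] (u ∈ V m × ∀ {n} → Agrees m n → PartInvComp A (_∈ V n) (Δ n) c u)
    PartInvComp-localise {c} pic =
      let j , 1≤j , j<k , u~γu = PartInvComp⇒ColConn-act A pic
          m , u∈ , walk = Reach-inStage T u~γu
      in m , u∈ , λ {n} (m≤n , agree) →
        ColConn-act⇒PartInvComp A (λ {x} → proj₁ (ST n j j<k) x) (proj₁ (proj₂ (Δ-symNAC n)) j j<k)
          1≤j j<k
          (Reach-map (λ (((_ , _ , e) , δxy≡c) , x∈ , y∈) →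
                        (V-mono T m≤n x∈ , V-mono T m≤n y∈ , e) , trans (agree x∈ y∈) δxy≡c)
                     walk)

    δ-partInvComp : ∀ c u v → EdgeIn G AllV u v →
                    PartInvComp A AllV δ c u → PartInvComp A AllV δ c v → ¬ ¬ ColConn A AllV δ c u v
    δ-partInvComp c u v uv@(_ , _ , e) pic-u pic-v ¬u~v with δ u v Bool.≟ c
    ... | yes δuv≡c = ¬u~v (step (uv , δuv≡c) here)
    ... | no δuv≢c =
      let mᵤ , u∈ , pic-uₙ = PartInvComp-localise pic-u
          mᵥ , v∈ , pic-vₙ = PartInvComp-localise pic-v
          u∈ₘ = V-mono T (m≤m⊔n mᵤ mᵥ) u∈
          v∈ₘ = V-mono T (m≤n⊔m mᵤ mᵥ) v∈
          n , m≤n , agree = agreeing (mᵤ ⊔ mᵥ)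
          uvₙ = V-mono T m≤n u∈ₘ , V-mono T m≤n v∈ₘ , e
      in proj₂ (proj₂ (Δ-symNAC n)) c u v uvₙ
           (pic-uₙ (Agrees-weaken (m≤m⊔n mᵤ mᵥ) (m≤n , agree)))
           (pic-vₙ (Agrees-weaken (m≤n⊔m mᵤ mᵥ) (m≤n , agree)))
           (¬ColConn-across-edge A (proj₁ (Δ-symNAC n)) uvₙ (δuv≢c ∘ trans (sym (agree u∈ₘ v∈ₘ))))

    module _ {a₁ b₁ a₂ b₂ : ℕ}
             (e₁ : EdgeIn G (_∈ V 0) a₁ b₁) (e₂ : EdgeIn G (_∈ V 0) a₂ b₂)
             (Δ-separates : ∀ n → Δ n a₁ b₁ ≢ Δ n a₂ b₂) where

      δ-separates : δ a₁ b₁ ≢ δ a₂ b₂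
      δ-separates δ₁≡δ₂ =
        let n , _ , agree = agreeing 0
            (a₁∈ , b₁∈ , _) = e₁
            (a₂∈ , b₂∈ , _) = e₂
        in Δ-separates n (trans (agree a₁∈ b₁∈) (trans δ₁≡δ₂ (sym (agree a₂∈ b₂∈))))

      δ-hasColour : ∀ c → ∃[ u ] ∃[ v ] (EdgeIn G AllV u v × δ u v ≡ c)
      δ-hasColour c with δ a₁ b₁ Bool.≟ c
      ... | yes δ₁≡c = a₁ , b₁ , (tt , tt , proj₂ (proj₂ e₁)) , δ₁≡c
      ... | no δ₁≢c  = a₂ , b₂ , (tt , tt , proj₂ (proj₂ e₂)) ,
                       trans (¬-not (≢-sym δ-separates)) (sym (¬-not (≢-sym δ₁≢c)))

      δ-symNAC : SymNAC A AllV δ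
      δ-symNAC = (δ-sym , δ-hasColour true , δ-hasColour false , δ-cycles) , δ-invariant , δ-partInvComp

lemma6p8 : ExcludedMiddle 0ℓ →
    (k : ℕ) → 2 ≤ k →
    (G : Graph) (A : CAction k G) →
    Connected G AllV → SymmetricGraph A →
    (T : SubgraphTower G) → SymmetricTower A T →
    (a₁ b₁ a₂ b₂ : ℕ) →
    EdgeIn G (_∈ SubgraphTower.V T 0) a₁ b₁ →
    EdgeIn G (_∈ SubgraphTower.V T 0) a₂ b₂ →
    (∀ n → ∃[ δ ] (SymNAC A (_∈ SubgraphTower.V T n) δ × δ a₁ b₁ ≢ δ a₂ b₂)) →
    ∃[ δ ] SymNAC A AllV δ
lemma6p8 em k _ G A _ _ T ST a₁ b₁ a₂ b₂ e₁ e₂ colourings =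
  δ , δ-symNAC ST (proj₁ ∘ proj₂ ∘ colourings) e₁ e₂ (proj₂ ∘ proj₂ ∘ colourings)
  where open Limit em A T (proj₁ ∘ colourings)
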